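{- For every positive integer $n$, every $k\in K(n)$ and every $t\in E(n,k)$, one has $V_f(t)\subseteq\mathrm{dom}(k)$ and $V_b(t)\subseteq V\setminus\mathrm{dom}(k)$.
   Context: Language $(V,F,C,\#)$: variables $V$; constants $C$ with meanings $\#(c)$; operator symbols $F$, each $f$ with applicability condition $A_f(x_1,\dots,x_n)$ on finite sequences of objects and value $P_f(x_1,\dots,x_n)$ when applicable; auxiliary symbols $($, $)$, $,$, $:$, $\{\}$; all disjoint and uniquely readable; expressions are strings. Soops: finite sequences of ordered pairs; $\varepsilon$ empty, $\|$ concatenation, pairs identified with one-term soops; $\mathrm{dom}$ = set of first components; $\alpha(a)=b$ for soops with distinct first components; $\alpha\sqsubseteq\gamma$: $\alpha$ is an initial segment of $\gamma$. Simultaneous induction on $n\ge1$ defining contexts $K(n)$, states $\Xi(k)$, expressions $E(n,k)$, meanings $\#(k,t,\sigma)$, bound/free variable sets $V_b(t),V_f(t)$: $K(1)=\{\varepsilon\}$, $\Xi(\varepsilon)=\{\varepsilon\}$, $E(1,\varepsilon)=C$, $\#(\varepsilon,c,\varepsilon)=\#(c)$, $V_b(c)=V_f(c)=\emptyset$. $K(n)^+$: all $h\|(y,\varphi)$, $h\in K(n)$, $\varphi\in E(n,h)$, $y\in V\setminus\mathrm{dom}(h)$, $\#(h,\varphi,\rho)$ a set for all $\rho\in\Xi(h)$; $K(n+1)=K(n)\cup K(n)^+$; $\Xi(h\|(y,\varphi))=\{\rho\|(y,s):\rho\in\Xi(h),s\in\#(h,\varphi,\rho)\}$. $E(n+1,k)$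 is the union of: (0) $E(n,k)$ if $k\in K(n)$; (a) for $k=h\|(y,\varphi)\in K(n)^+$, $t\in E(n,h)$ with $y\notin V_b(t)$, $\#(k,t,\rho\|(y,s))=\#(h,t,\rho)$, $V_b,V_f$ unchanged; (b) for such $k$, $y$ itself, $\#(k,y,\sigma)=\sigma(y)$, $V_f(y)=\{y\}$, $V_b(y)=\emptyset$; (c) for $k\in K(n)$, $(\varphi)(\varphi_1,\dots,\varphi_m)$ with $\varphi,\varphi_i\in E(n,k)$, $\#(k,\varphi,\sigma)$ an $m$-ary function defined at $(\#(k,\varphi_i,\sigma))_i$ for all $\sigma$, meaning its value, $V_b$ (resp. $V_f$) the union of $V_b$ (resp. $V_f$) of $\varphi,\varphi_1,\dots,\varphi_m$; (d) for $k\in K(n)$, $(f)(\varphi_1,\dots,\varphi_m)$, $f\in F$, $\varphi_i\in E(n,k)$, $A_f(\#(k,\varphi_1,\sigma),\dots)$ for all $\sigma$, meaning $P_f(\dots)$, $V_b,V_f$ unions over the $\varphi_i$; (e) for $k\in K(n)$, $\{\}(x_1:\varphi_1,\dots,x_m:\varphi_m,\varphi)$, $x_i$ distinct in $V\setminus\mathrm{dom}(k)$, $k'_i=k\|(x_1,\varphi_1)\|\dots\|(x_i,\varphi_i)\in K(n)$, $\varphi_i\in E(n,k'_{i-1})$ with $\#(k'_{i-1},\varphi_i,\rho)$ a set for all $\rho$, $\varphi\in E(n,k'_m)$; meaning $\{\#(k'_m,\varphi,\sigma'):\sigma'\in\Xi(k'_m),\sigma\sqsubseteq\sigma'\}$;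 $V_b=\{x_1,\dots,x_m\}\cup\bigcup V_b(\varphi_i)\cup V_b(\varphi)$; $V_f=V_f(\varphi_1)\cup(V_f(\varphi_2)\setminus\{x_1\})\cup\dots\cup(V_f(\varphi_m)\setminus\{x_1,\dots,x_{m-1}\})\cup(V_f(\varphi)\setminus\{x_1,\dots,x_m\})$. (These clauses are consistent, so all notions are well defined.) -}

module Defs where

open import Data.Nat using (ℕ; zero; suc)
open import Data.List using (List; []; _∷_; _++_; [_]; map; length; _∷ʳ_)
open import Data.List.Membership.Propositional using (_∈_; _∉_)
open import Data.List.Relation.Unary.All using (All)
open import Data.List.Relation.Unary.Any using (Any)
open import Data.List.Relation.Binary.Pointwise using (Pointwise)
open import Data.List.Relation.Unary.Unique.Propositional using (Unique)
open import Data.Product using (Σ; Σ-syntax; ∃; _×_; _,_; proj₁)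
open import Data.Sum using (_⊎_)
open import Data.Empty using (⊥)
open import Relation.Nullary using (¬_)
open import Relation.Binary.PropositionalEquality using (_≡_; _≢_)

-- A language (V, F, C, #) together with the universe of objects in
-- which meanings live.

record Language : Set₁ where
  field
    Var   : Set
    Con   : Set
    Op    : Set
    Obj   : Set
    IsSet : Obj → Set
    _∋ₒ_  : Obj → Obj → Set        -- X ∋ₒ s : "s ∈ X"
    IsFun : ℕ → Obj → Set
    DefAt : Obj → List Obj → Set
    app   : Obj → List Obj → Obj
    collect : (Obj → Set) → Obj
    ⟦_⟧   : Con → Obj
    A     : Op → List Obj → Set    -- applicability condition A_f
    P     : Op → List Obj → Obj    -- value P_f

module Syntax (L : Language) where
  open Language L

  -- symbols: variables, constants, operators and the auxiliary
  -- symbols ( ) , : {} ; all disjoint by construction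
  data Sym : Set where
    var    : Var → Sym
    con    : Con → Sym
    op     : Op → Sym
    lp rp comma colon braces : Sym

  Expr : Set
  Expr = List Sym

  -- soops whose second components are expressions (contexts)
  Soop : Set
  Soop = List (Var × Expr)

  -- soops whose second components are objects (states)
  State : Set
  State = List (Var × Obj)

  dom : {B : Set} → List (Var × B) → List Var
  dom = map proj₁

  _⊑_ : State → State → Set
  α ⊑ γ = ∃ λ τ → γ ≡ α ++ τ

  commaSep : List Expr → Expr
  commaSep [] = []
  commaSep (e ∷ []) = e
  commaSep (e ∷ e' ∷ es) = e ++ comma ∷ commaSep (e' ∷ es)

  appExpr : Expr → List Expr → Expr
  appExpr φ φs = lp ∷ φ ++ rp ∷ lp ∷ commaSep φs ++ [ rp ]

  opExpr : Op → List Expr → Expr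
  opExpr f φs = lp ∷ op f ∷ rp ∷ lp ∷ commaSep φs ++ [ rp ]

  binders : Soop → Expr
  binders [] = []
  binders ((x , ψ) ∷ bs) = var x ∷ colon ∷ ψ ++ comma ∷ binders bs

  setExpr : Soop → Expr → Expr
  setExpr bs φ = braces ∷ lp ∷ binders bs ++ φ ++ [ rp ]

  -- The data of one stage n of the simultaneous induction:
  --   K k        : k ∈ K(n)
  --   Ξ k σ      : σ ∈ Ξ(k)
  --   E k t      : t ∈ E(n,k)
  --   M k t σ x  : #(k,t,σ) = x
  --   Vb k t v   : v ∈ V_b(t)   (t formed in context k)
  --   Vf k t v   : v ∈ V_f(t)
  record Stage : Set₁ where
    field
      K  : Soop → Set
      Ξ  : Soop → State → Set
      E  : Soop → Expr → Set
      M  : Soop → Expr → State → Obj → Set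
      Vb : Soop → Expr → Var → Set
      Vf : Soop → Expr → Var → Set

  base : Stage
  base = record
    { K  = λ k → k ≡ []
    ; Ξ  = λ k σ → k ≡ [] × σ ≡ []
    ; E  = λ k t → k ≡ [] × Σ[ c ∈ Con ] t ≡ [ con c ]
    ; M  = λ k t σ x → k ≡ [] × σ ≡ [] × Σ[ c ∈ Con ] (t ≡ [ con c ] × x ≡ ⟦ c ⟧)
    ; Vb = λ _ _ _ → ⊥
    ; Vf = λ _ _ _ → ⊥
    }

  empty : Stage
  empty = record
    { K = λ _ → ⊥ ; Ξ = λ _ _ → ⊥ ; E = λ _ _ → ⊥ ; M = λ _ _ _ _ → ⊥
    ; Vb = λ _ _ _ → ⊥ ; Vf = λ _ _ _ → ⊥ }

  module Next (S : Stage) where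
    open Stage S

    SetValued : Soop → Expr → Set
    SetValued h φ = ∀ ρ → Ξ h ρ → ∀ X → M h φ ρ X → IsSet X

    PlusCond : Soop → Var → Expr → Set
    PlusCond h y φ = K h × E h φ × y ∉ dom h × SetValued h φ

    KPlus : Soop → Set
    KPlus k = Σ[ h ∈ Soop ] Σ[ y ∈ Var ] Σ[ φ ∈ Expr ]
                (k ≡ h ∷ʳ (y , φ) × PlusCond h y φ)

    K' : Soop → Set
    K' k = K k ⊎ KPlus k

    ΞPlus : Soop → State → Set
    ΞPlus k σ = Σ[ h ∈ Soop ] Σ[ y ∈ Var ] Σ[ φ ∈ Expr ]
                  (k ≡ h ∷ʳ (y , φ) × PlusCond h y φ ×
                   Σ[ ρ ∈ State ] Σ[ s ∈ Obj ]
                     (Ξ h ρ × (Σ[ X ∈ Obj ] (M h φ ρ X × X ∋ₒ s)) × σ ≡ ρ ∷ʳ (y , s)))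

    Ξ' : Soop → State → Set
    Ξ' k σ = Ξ k σ ⊎ ΞPlus k σ

    -- "bs ≡ pre ++ (x , ψ) ∷ post" : (x,ψ) is the i-th binder
    Split : Soop → Soop → Var → Expr → Soop → Set
    Split bs pre x ψ post = bs ≡ pre ++ (x , ψ) ∷ post

    -- derivations of t ∈ E(n+1,k)
    data Der (k : Soop) (t : Expr) : Set where
      -- (0)
      d0 : K k → E k t → Der k t
      -- (a)
      da : (h : Soop) (y : Var) (φ : Expr) → k ≡ h ∷ʳ (y , φ) → PlusCond h y φ →
           E h t → ¬ Vb h t y → Der k t
      -- (b)
      db : (h : Soop) (y : Var) (φ : Expr) → k ≡ h ∷ʳ (y , φ) → PlusCond h y φ →
           t ≡ [ var y ] → Der k t
      -- (c)
      dc : K k → (φ : Expr) (φs : List Expr) → t ≡ appExpr φ φs →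
           E k φ → All (E k) φs →
           (∀ σ → Ξ k σ → ∀ f xs → M k φ σ f →
              Pointwise (λ ψ x → M k ψ σ x) φs xs →
              IsFun (length φs) f × DefAt f xs) →
           Der k t
      -- (d)
      dd : K k → (f : Op) (φs : List Expr) → t ≡ opExpr f φs →
           All (E k) φs →
           (∀ σ → Ξ k σ → ∀ xs → Pointwise (λ ψ x → M k ψ σ x) φs xs → A f xs) →
           Der k t
      -- (e)  (binders bs = (x₁,φ₁)…(xₘ,φₘ), m ≥ 1)
      de : K k → (bs : Soop) (φ : Expr) → bs ≢ [] → t ≡ setExpr bs φ →
           Unique (dom bs) → (∀ x → x ∈ dom bs → x ∉ dom k) →
           (∀ pre x ψ post → Split bs pre x ψ post →
              K (k ++ pre ∷ʳ (x , ψ)) × E (k ++ pre) ψ × SetValued (k ++ pre) ψ) →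
           E (k ++ bs) φ →
           Der k t

    MeanD : ∀ {k t} → Der k t → State → Obj → Set
    MeanD {k} {t} (d0 _ _) σ x = M k t σ x
    MeanD {k} {t} (da h y φ _ _ _ _) σ x =
      Σ[ ρ ∈ State ] Σ[ s ∈ Obj ] (σ ≡ ρ ∷ʳ (y , s) × M h t ρ x)
    MeanD (db h y φ _ _ _) σ x = (y , x) ∈ σ
    MeanD {k} (dc _ φ φs _ _ _ _) σ x =
      Σ[ f ∈ Obj ] Σ[ xs ∈ List Obj ]
        (M k φ σ f × Pointwise (λ ψ z → M k ψ σ z) φs xs × x ≡ app f xs)
    MeanD {k} (dd _ f φs _ _ _) σ x =
      Σ[ xs ∈ List Obj ] (Pointwise (λ ψ z → M k ψ σ z) φs xs × x ≡ P f xs)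
    MeanD {k} (de _ bs φ _ _ _ _ _ _) σ x =
      x ≡ collect (λ z → Σ[ σ' ∈ State ] (Ξ (k ++ bs) σ' × σ ⊑ σ' × M (k ++ bs) φ σ' z))

    VbD : ∀ {k t} → Der k t → Var → Set
    VbD {k} {t} (d0 _ _) v = Vb k t v
    VbD {k} {t} (da h _ _ _ _ _ _) v = Vb h t v
    VbD (db _ _ _ _ _ _) v = ⊥
    VbD {k} (dc _ φ φs _ _ _ _) v = Vb k φ v ⊎ Any (λ ψ → Vb k ψ v) φs
    VbD {k} (dd _ _ φs _ _ _) v = Any (λ ψ → Vb k ψ v) φs
    VbD {k} (de _ bs φ _ _ _ _ _ _) v =
      v ∈ dom bs
      ⊎ (Σ[ pre ∈ Soop ] Σ[ x ∈ Var ] Σ[ ψ ∈ Expr ] Σ[ post ∈ Soop ]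
           (Split bs pre x ψ post × Vb (k ++ pre) ψ v))
      ⊎ Vb (k ++ bs) φ v

    VfD : ∀ {k t} → Der k t → Var → Set
    VfD {k} {t} (d0 _ _) v = Vf k t v
    VfD {k} {t} (da h _ _ _ _ _ _) v = Vf h t v
    VfD (db _ y _ _ _ _) v = v ≡ y
    VfD {k} (dc _ φ φs _ _ _ _) v = Vf k φ v ⊎ Any (λ ψ → Vf k ψ v) φs
    VfD {k} (dd _ _ φs _ _ _) v = Any (λ ψ → Vf k ψ v) φs
    VfD {k} (de _ bs φ _ _ _ _ _ _) v =
      (Σ[ pre ∈ Soop ] Σ[ x ∈ Var ] Σ[ ψ ∈ Expr ] Σ[ post ∈ Soop ]
          (Split bs pre x ψ post × Vf (k ++ pre) ψ v × v ∉ dom pre))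
      ⊎ (Vf (k ++ bs) φ v × v ∉ dom bs)

    next : Stage
    next = record
      { K  = K'
      ; Ξ  = Ξ'
      ; E  = Der
      ; M  = λ k t σ x → Σ[ d ∈ Der k t ] MeanD d σ x
      ; Vb = λ k t v → Σ[ d ∈ Der k t ] VbD d v
      ; Vf = λ k t v → Σ[ d ∈ Der k t ] VfD d v
      }

  -- stage n (stage 0 is empty and unused; stage 1 is the base)
  stage : ℕ → Stage
  stage zero = empty
  stage (suc zero) = base
  stage (suc (suc n)) = Next.next (stage (suc n))

  Kₙ : ℕ → Soop → Set
  Kₙ n = Stage.K (stage n)

  Eₙ : ℕ → Soop → Expr → Set
  Eₙ n = Stage.E (stage n)

  Vbₙ : ℕ → Soop → Expr → Var → Set
  Vbₙ n = Stage.Vb (stage n)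

  Vfₙ : ℕ → Soop → Expr → Var → Set
  Vfₙ n = Stage.Vf (stage n)

module Submission where

-- Call a stage S of the simultaneous induction *scoped* when every
-- t ∈ E(k) with k ∈ K satisfies V_f(t) ⊆ dom k and V_b(t) ∩ dom k = ∅.
-- The theorem is that every stage n ≥ 1 is scoped, by induction on n:
-- stage 1 has no variables at all, and the construction of stage n+1
-- preserves scopedness.  For the induction step we inspect the clause
-- (0), (a)–(e) that produced t:
--   * (0), (c), (d) are immediate from the hypothesis on subexpressions;
--   * (a), (b) extend the context by one entry (y , φ) — the side
--     condition y ∉ V_b(t) of (a) is exactly what keeps V_b fresh;
--   * (e) uses the hypothesis in the extended contexts k‖x₁:φ₁‖…; that
--     these are contexts again is read off from the side conditions of
--     (e), and the variables x_i removed from V_f are precisely the ones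
--     added to the context, while the x_i themselves are fresh for k.

open import Defs
open import Data.Nat using (ℕ; _≤_; zero; suc; s≤s)
open import Data.Product using (_×_; _,_; proj₁; proj₂)
open import Data.Sum using (_⊎_; inj₁; inj₂)
open import Data.Empty using (⊥-elim)
open import Data.List using (List; []; _∷_; _++_; [_]; _∷ʳ_; initLast; _∷ʳ′_)
open import Data.List.Properties using (map-++; ++-assoc; ++-identityʳ)
open import Data.List.Membership.Propositional using (_∈_; _∉_)
open import Data.List.Membership.Propositional.Properties using (∈-++⁻; ∈-++⁺ˡ; ∈-++⁺ʳ)
open import Data.List.Relation.Unary.All using (lookupWith)
open import Data.List.Relation.Unary.Any using (here; there)
open import Relation.Binary.PropositionalEquality using (_≡_; _≢_; refl; sym; trans; subst)

module Scoping (L : Language) where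
  open Language L
  open Syntax L

  dom-++ : {B : Set} (a b : List (Var × B)) → dom (a ++ b) ≡ dom a ++ dom b
  dom-++ a b = map-++ proj₁ a b

  ∈-dom-++ˡ : {B : Set} {v : Var} (a b : List (Var × B)) → v ∈ dom a → v ∈ dom (a ++ b)
  ∈-dom-++ˡ a b p = subst (_ ∈_) (sym (dom-++ a b)) (∈-++⁺ˡ p)

  ∈-dom-++-∉ʳ : {B : Set} {v : Var} (a b : List (Var × B)) →
    v ∈ dom (a ++ b) → v ∉ dom b → v ∈ dom a
  ∈-dom-++-∉ʳ a b p v∉b with ∈-++⁻ (dom a) (subst (_ ∈_) (dom-++ a b) p)
  ... | inj₁ v∈a = v∈a
  ... | inj₂ v∈b = ⊥-elim (v∉b v∈b)

  ∈-dom-∷ʳ⁺ : {B : Set} {y : Var} {φ : B} (h : List (Var × B)) → y ∈ dom (h ∷ʳ (y , φ))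
  ∈-dom-∷ʳ⁺ h = subst (_ ∈_) (sym (dom-++ h _)) (∈-++⁺ʳ (dom h) (here refl))

  ∈-dom-∷ʳ⁻ : {B : Set} {v y : Var} {φ : B} (h : List (Var × B)) →
    v ∈ dom (h ∷ʳ (y , φ)) → v ∈ dom h ⊎ v ≡ y
  ∈-dom-∷ʳ⁻ h p with ∈-++⁻ (dom h) (subst (_ ∈_) (dom-++ h _) p)
  ... | inj₁ v∈h = inj₁ v∈h
  ... | inj₂ (here v≡y) = inj₂ v≡y

  Scoped : Stage → Soop → Expr → Set
  Scoped S k t = (∀ v → Stage.Vf S k t v → v ∈ dom k)
               × (∀ v → Stage.Vb S k t v → v ∉ dom k)

  ScopedStage : Stage → Set
  ScopedStage S = ∀ k t → Stage.K S k → Stage.E S k t → Scoped S k t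

  -- Stage 1 consists of constants, which have no variables.
  base-scoped : ScopedStage base
  base-scoped k t _ _ = (λ v ()) , (λ v ())

  module Step (S : Stage) (ih : ScopedStage S) where
    open Stage S
    open Next S

    BinderCond : Soop → Soop → Set
    BinderCond k bs = ∀ pre x ψ post → Split bs pre x ψ post →
      K (k ++ pre ∷ʳ (x , ψ)) × E (k ++ pre) ψ × SetValued (k ++ pre) ψ

    -- Each intermediate context k‖(x₁,φ₁)‖…‖(x_{i-1},φ_{i-1}) is a context:
    -- for i = 1 it is k, otherwise the condition for binder i-1 says so.
    prefix-context : ∀ {k bs} → K k → BinderCond k bs →
      ∀ pre x ψ post → Split bs pre x ψ post → K (k ++ pre)
    prefix-context {k} Kk cond pre x ψ post split with initLast pre
    ... | [] = subst K (sym (++-identityʳ k)) Kk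
    ... | pre' ∷ʳ′ (x' , ψ') =
      proj₁ (cond pre' x' ψ' ((x , ψ) ∷ post)
                  (trans split (++-assoc pre' [ (x' , ψ') ] ((x , ψ) ∷ post))))

    body-context : ∀ {k bs} → K k → bs ≢ [] → BinderCond k bs → K (k ++ bs)
    body-context {bs = bs} Kk nonempty cond with initLast bs
    ... | [] = ⊥-elim (nonempty refl)
    ... | pre ∷ʳ′ (x , ψ) = proj₁ (cond pre x ψ [] refl)

    binder-scoped : ∀ {k bs} → K k → BinderCond k bs →
      ∀ pre x ψ post → Split bs pre x ψ post → Scoped S (k ++ pre) ψ
    binder-scoped Kk cond pre x ψ post split =
      ih _ ψ (prefix-context Kk cond pre x ψ post split)
             (proj₁ (proj₂ (cond pre x ψ post split)))

    -- V_f(t) ⊆ dom k for t ∈ E(n+1,k), by the clause deriving t; in (e) the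
    -- variables x_i dropped from V_f are exactly the entries added to k.
    free⊆dom : ∀ {k t v} → (d : Der k t) → VfD d v → v ∈ dom k
    free⊆dom (d0 Kk e) p = proj₁ (ih _ _ Kk e) _ p
    free⊆dom (da h y φ refl (Kh , _) e _) p = ∈-dom-++ˡ h _ (proj₁ (ih h _ Kh e) _ p)
    free⊆dom (db h y φ refl _ _) refl = ∈-dom-∷ʳ⁺ h
    free⊆dom (dc Kk φ φs _ e es _) (inj₁ p) = proj₁ (ih _ φ Kk e) _ p
    free⊆dom (dc Kk φ φs _ e es _) (inj₂ p) =
      lookupWith (λ e' p' → proj₁ (ih _ _ Kk e') _ p') es p
    free⊆dom (dd Kk f φs _ es _) p =
      lookupWith (λ e' p' → proj₁ (ih _ _ Kk e') _ p') es p
    free⊆dom {k} (de Kk bs φ _ _ _ _ cond _) (inj₁ (pre , x , ψ , post , split , p , v∉pre)) =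
      ∈-dom-++-∉ʳ k pre (proj₁ (binder-scoped Kk cond pre x ψ post split) _ p) v∉pre
    free⊆dom {k} (de Kk bs φ nonempty _ _ _ cond e) (inj₂ (p , v∉bs)) =
      ∈-dom-++-∉ʳ k bs (proj₁ (ih _ φ (body-context Kk nonempty cond) e) _ p) v∉bs

    -- V_b(t) is fresh for k; in (a) the new variable y is excluded by the
    -- side condition y ∉ V_b(t), in (e) the x_i are fresh by hypothesis.
    bound∉dom : ∀ {k t v} → (d : Der k t) → VbD d v → v ∉ dom k
    bound∉dom (d0 Kk e) p = proj₂ (ih _ _ Kk e) _ p
    bound∉dom (da h y φ refl (Kh , _) e y∉Vb) p v∈k with ∈-dom-∷ʳ⁻ h v∈k
    ... | inj₁ v∈h = proj₂ (ih h _ Kh e) _ p v∈h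
    ... | inj₂ refl = y∉Vb p
    bound∉dom (db h y φ refl _ _) ()
    bound∉dom (dc Kk φ φs _ e es _) (inj₁ p) = proj₂ (ih _ φ Kk e) _ p
    bound∉dom (dc Kk φ φs _ e es _) (inj₂ p) =
      lookupWith (λ e' p' → proj₂ (ih _ _ Kk e') _ p') es p
    bound∉dom (dd Kk f φs _ es _) p =
      lookupWith (λ e' p' → proj₂ (ih _ _ Kk e') _ p') es p
    bound∉dom (de Kk bs φ _ _ _ fresh _ _) (inj₁ p) = fresh _ p
    bound∉dom {k} (de Kk bs φ _ _ _ _ cond _) (inj₂ (inj₁ (pre , x , ψ , post , split , p))) v∈k =
      proj₂ (binder-scoped Kk cond pre x ψ post split) _ p (∈-dom-++ˡ k pre v∈k)
    bound∉dom {k} (de Kk bs φ nonempty _ _ _ cond e) (inj₂ (inj₂ p)) v∈k =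
      proj₂ (ih _ φ (body-context Kk nonempty cond) e) _ p (∈-dom-++ˡ k bs v∈k)

    next-scoped : ScopedStage next
    next-scoped k t _ _ = (λ v (d , p) → free⊆dom d p)
                         , (λ v (d , p) → bound∉dom d p)

  stage-scoped : ∀ n → ScopedStage (stage (suc n))
  stage-scoped zero = base-scoped
  stage-scoped (suc n) = Step.next-scoped (stage (suc n)) (stage-scoped n)

lemma2p2 : (L : Language) (n : ℕ) → 1 ≤ n →
    (k : Syntax.Soop L) → Syntax.Kₙ L n k →
    (t : Syntax.Expr L) → Syntax.Eₙ L n k t →
    (∀ v → Syntax.Vfₙ L n k t v → v ∈ Syntax.dom L k)
    × (∀ v → Syntax.Vbₙ L n k t v → v ∉ Syntax.dom L k)
lemma2p2 L (suc n) (s≤s _) k Kk t e = Scoping.stage-scoped L n k t Kk e
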